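{- A trihex has coinciding signatures if and only if it has a signature of the form $(tm-1,\ m-1,\ gm)$ for some integers $t\ge1$, $m\ge 1$, $0\le g<t$ with $g^2+g+1\equiv 0\pmod t$.
   Context: A trihex is a 3-regular graph embedded in the plane (equivalently the sphere) whose faces all have 3 or 6 sides, considered up to orientation-preserving homeomorphism. Every trihex arises as the quotient of the regular hexagonal tiling of the plane, positioned so the hexagons lie in vertical columns, by the group generated by $180^\circ$ rotations about the centers of a set of "special" hexagons whose centers form the vertices of a parallelogram lattice. Columns containing special hexagons are spine columns, the others are belt columns. The spine length $s\ge0$ is the number of hexagons strictly between two consecutive special hexagons in a spine column; $b\ge 0$ is the number of belt columns between two adjacent spine columns; the offset $f$ with $0\le f\le s$ is defined by: translating a special hexagon $b+1$ columns in the SW-to-NE direction lands it $f$ hexagons below a special hexagon. The triple $(s,b,f)$ is a signature of the trihex. Using instead columns of hexagons in the directions $60^\circ$ and $120^\circ$ clockwise from north gives two further signatures; these three signatures are the equivalent signatures of the trihex. If $(s_1,b_1,f_1)$ is one signature and $h=2s_1b_1+2s_1+2b_1$ (the number of hexagonal faces), the other two are given by: $s_2=j_2(b_1+1)-1$ where $j_2$ is the order of $f_1$ in $\mathbb{Z}_{s_1+1}$; $b_2=\frac{h-2s_2}{2s_2+2}$; $f_2\equiv -p_2(b_1+1)-(b_2+1)\pmod{s_2+1}$ where $p_2$ is the least positive integer with $p_2f_1\equiv b_2+1\pmod{s_1+1}$; $s_3=j_3(b_1+1)-1$ where $j_3$ is the order of $f_1+b_1+1$ in $\mathbb{Z}_{s_1+1}$;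 $b_3=\frac{h-2s_3}{2s_3+2}$; $f_3\equiv -p_3(b_1+1)\pmod{s_3+1}$ where $p_3$ is the least positive integer with $p_3(f_1+b_1+1)\equiv b_3+1\pmod{s_1+1}$ (each $f_i$ taken in $[0,s_i]$). A trihex has coinciding signatures if its three equivalent signatures are the same triple of numbers. -}

module Defs where

open import Data.Nat using (ℕ; zero; suc; _+_; _*_; _∸_; _≡ᵇ_)
open import Data.Nat.DivMod using (_/_; _%_)
open import Data.Bool using (Bool; if_then_else_)
open import Data.Product using (_×_; _,_)
open import Data.Sum using (_⊎_)
open import Relation.Binary.PropositionalEquality using (_≡_)

Signature : Set
Signature = ℕ × ℕ × ℕ

-- search fuel k P : the least j ∈ {k, …, k + fuel - 1} with P j = true
-- (returns 0 if there is none).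
search : ℕ → ℕ → (ℕ → Bool) → ℕ
search zero    k P = 0
search (suc fuel) k P = if P k then k else search fuel (suc k) P

-- least positive integer j with P j, provided it lies in {1,…,n}.
-- For a condition periodic mod n that has a solution, this is the
-- least positive solution.
leastPos : ℕ → (ℕ → Bool) → ℕ
leastPos n P = search n 1 P

order : (k a : ℕ) → ℕ
order k a = leastPos (suc k) (λ j → ((j * a) % suc k) ≡ᵇ 0)

hexes : Signature → ℕ
hexes (s , b , f) = 2 * s * b + 2 * s + 2 * b

negMod : (k x : ℕ) → ℕ
negMod k x = (suc k ∸ (x % suc k)) % suc k

sig2 : Signature → Signature
sig2 (s₁ , b₁ , f₁) = s₂ , b₂ , f₂
  where
  h  = hexes (s₁ , b₁ , f₁)
  j₂ = order s₁ f₁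
  s₂ = j₂ * (b₁ + 1) ∸ 1
  b₂ = (h ∸ 2 * s₂) / suc (2 * s₂ + 1)
  p₂ = leastPos (suc s₁) (λ p → ((p * f₁) % suc s₁) ≡ᵇ ((b₂ + 1) % suc s₁))
  f₂ = negMod s₂ (p₂ * (b₁ + 1) + (b₂ + 1))

sig3 : Signature → Signature
sig3 (s₁ , b₁ , f₁) = s₃ , b₃ , f₃
  where
  h  = hexes (s₁ , b₁ , f₁)
  j₃ = order s₁ (f₁ + b₁ + 1)
  s₃ = j₃ * (b₁ + 1) ∸ 1
  b₃ = (h ∸ 2 * s₃) / suc (2 * s₃ + 1)
  p₃ = leastPos (suc s₁) (λ p → ((p * (f₁ + b₁ + 1)) % suc s₁) ≡ᵇ ((b₃ + 1) % suc s₁))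
  f₃ = negMod s₃ (p₃ * (b₁ + 1))

IsEquivSig : Signature → Signature → Set
IsEquivSig σ σ′ = σ′ ≡ σ ⊎ σ′ ≡ sig2 σ ⊎ σ′ ≡ sig3 σ

CoincidingSignatures : Signature → Set
CoincidingSignatures σ = sig2 σ ≡ σ × sig3 σ ≡ σ

{-# OPTIONS --safe #-}
module Submission where

-- Write N = s + 1 and k = b + 1.  Both other signatures are instances of one formula, `rotated s b a e`
-- (a = f, e = 1 for the second, a = f + k, e = 0 for the third): if a / N = a′ / j in lowest terms
-- with common factor d, it is (jk - 1, d - 1, -(pk + ed) mod jk), where p is an inverse of a′ mod j.
--
-- If t ∣ g² + g + 1 then g (g + 1) ≡ -1 (mod t), so g and g + 1 are units mod t with inverses
-- -(g + 1) and -g.  For σ = (tm - 1, m - 1, gm) this gives j = t, d = m, a′ = g resp. g + 1, and the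
-- offset -(pm + em) ≡ gm (mod tm) is reproduced: σ has coinciding signatures.  Conversely, if a
-- rotation of σ is (tm - 1, m - 1, gm), the spine and belt counts give jk = tm and d = m; as p is a
-- unit mod j and g + e a unit mod t, this forces j = t, k = m and a′ ≡ g + 1 - e (mod t), so σ was
-- (tm - 1, m - 1, gm) already.  Finally, if the second signature of σ is σ, then jk = N, d = k and
-- j ∣ a′ + p + 1; multiplying by a′ gives j ∣ a′² + a′ + 1, so σ = (jd - 1, d - 1, a′d) has the form.

open import Defs
open import Data.Bool using (Bool; true; false; T)
open import Data.Empty using (⊥-elim)
open import Data.List using (_∷_; [])
open import Data.Nat as ℕ using (ℕ; zero; suc; NonZero; _≡ᵇ_)
import Data.Nat.Properties as ℕ
import Data.Nat.Divisibility as ℕ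
import Data.Nat.Tactic.RingSolver as ℕ
open import Data.Nat.Coprimality as Coprime using (Coprime)
open import Data.Nat.DivMod
  using (_/_; _%_; m/n*n≡m; m*n/n≡m; m≡m%n+[m/n]*n; m%n≤n; [m+kn]%n≡m%n; m<n⇒m%n≡m; m%n<n)
open import Data.Nat.GCD using (gcd; gcd[m,n]∣m; gcd[m,n]∣n; gcd[m,n]≢0; module Bézout)
open import Data.Product using (Σ; _×_; _,_; proj₁; proj₂)
open import Data.Product.Properties using (,-injectiveˡ; ,-injectiveʳ)
open import Data.Sum using (inj₁; inj₂)
open import Relation.Binary.PropositionalEquality

search-least : ∀ fuel k (P : ℕ → Bool) {x} → k ℕ.≤ x → x ℕ.< k ℕ.+ fuel → T (P x) →
               (∀ {y} → k ℕ.≤ y → T (P y) → x ℕ.≤ y) → search fuel k P ≡ x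
search-least zero k P k≤x x<k _ _ = ⊥-elim (ℕ.≤⇒≯ k≤x (subst (_ ℕ.<_) (ℕ.+-identityʳ k) x<k))
search-least (suc fuel) k P {x} k≤x x<k+1+fuel Px least with P k in Pk
... | true  = ℕ.≤-antisym k≤x (least ℕ.≤-refl (subst T (sym Pk) _))
... | false = search-least fuel (suc k) P k<x (subst (x ℕ.<_) (ℕ.+-suc k fuel) x<k+1+fuel) Px
                (λ k<y → least (ℕ.<⇒≤ k<y))
  where
  k<x : k ℕ.< x
  k<x = ℕ.≤∧≢⇒< k≤x (λ { refl → subst T Pk Px })

search-sound : ∀ fuel k (P : ℕ → Bool) {x} → k ℕ.≤ x → x ℕ.< k ℕ.+ fuel → T (P x) →
               T (P (search fuel k P))
search-sound zero k P k≤x x<k _ = ⊥-elim (ℕ.≤⇒≯ k≤x (subst (_ ℕ.<_) (ℕ.+-identityʳ k) x<k))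
search-sound (suc fuel) k P {x} k≤x x<k+1+fuel Px with P k in Pk
... | true  = subst T (sym Pk) _
... | false = search-sound fuel (suc k) P k<x (subst (x ℕ.<_) (ℕ.+-suc k fuel) x<k+1+fuel) Px
  where
  k<x : k ℕ.< x
  k<x = ℕ.≤∧≢⇒< k≤x (λ { refl → subst T Pk Px })

record LowestTerms (a n : ℕ) : Set where
  constructor lowest
  field
    num den factor : ℕ
    a≡num*factor : a ≡ num ℕ.* factor
    n≡den*factor : n ≡ den ℕ.* factor
    coprime : Coprime num den

lowestTerms : ∀ a n .{{_ : NonZero n}} → LowestTerms a n
lowestTerms a n = record
  { num = a / d ; den = n / d ; factor = d
  ; a≡num*factor = sym (m/n*n≡m (gcd[m,n]∣m a n))
  ; n≡den*factor = sym (m/n*n≡m (gcd[m,n]∣n a n))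
  ; coprime = Coprime.coprime-/gcd a n
  }
  where
  d : ℕ
  d = gcd a n
  instance
    d≢0 : NonZero d
    d≢0 = ℕ.≢-nonZero (gcd[m,n]≢0 a n (inj₂ (ℕ.≢-nonZero⁻¹ n)))

module _ {a n : ℕ} .{{n≢0 : NonZero n}} (L : LowestTerms a n) where
  open LowestTerms L

  den-nonZero : NonZero den
  den-nonZero = ℕ.m*n≢0⇒m≢0 den {{subst NonZero n≡den*factor n≢0}}

  factor-nonZero : NonZero factor
  factor-nonZero = ℕ.m*n≢0⇒n≢0 den {{subst NonZero n≡den*factor n≢0}}

  den≤n : den ℕ.≤ n
  den≤n = subst (den ℕ.≤_) (sym n≡den*factor) (ℕ.m≤m*n den factor {{factor-nonZero}})

order≡den : ∀ s {a} (L : LowestTerms a (suc s)) → order s a ≡ LowestTerms.den L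
order≡den s {a} L@(lowest num den factor a≡num*factor n≡den*factor coprime) =
  search-least N 1 P (ℕ.>-nonZero⁻¹ den) (ℕ.s≤s (den≤n L)) (P-complete den N∣den*a) least
  where
  open ≡-Reasoning
  instance
    _ = den-nonZero L
    _ = factor-nonZero L
  N : ℕ
  N = suc s
  P : ℕ → Bool
  P j = ((j ℕ.* a) % N) ≡ᵇ 0
  P-complete : ∀ j → N ℕ.∣ j ℕ.* a → T (P j)
  P-complete j N∣ = ℕ.≡⇒≡ᵇ _ 0 (ℕ.n∣m⇒m%n≡0 _ N N∣)
  P-sound : ∀ j → T (P j) → N ℕ.∣ j ℕ.* a
  P-sound j Pj = ℕ.m%n≡0⇒n∣m _ N (ℕ.≡ᵇ⇒≡ _ 0 Pj)
  N∣den*a : N ℕ.∣ den ℕ.* a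
  N∣den*a = ℕ.divides num (begin
    den ℕ.* a                 ≡⟨ cong (den ℕ.*_) a≡num*factor ⟩
    den ℕ.* (num ℕ.* factor)  ≡⟨ ℕ.solve (den ∷ num ∷ factor ∷ []) ⟩
    num ℕ.* (den ℕ.* factor)  ≡⟨ cong (num ℕ.*_) n≡den*factor ⟨
    num ℕ.* N                 ∎)
  least : ∀ {y} → 1 ℕ.≤ y → T (P y) → den ℕ.≤ y
  least {y} 1≤y Py = ℕ.∣⇒≤ {{ℕ.>-nonZero 1≤y}} (Coprime.coprime-divisor (Coprime.sym coprime) den∣num*y)
    where
    den∣num*y : den ℕ.∣ num ℕ.* y
    den∣num*y = ℕ.*-cancelʳ-∣ factor (subst₂ ℕ._∣_ n≡den*factor (begin
      y ℕ.* a                 ≡⟨ cong (y ℕ.*_) a≡num*factor ⟩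
      y ℕ.* (num ℕ.* factor)  ≡⟨ ℕ.solve (y ∷ num ∷ factor ∷ []) ⟩
      num ℕ.* y ℕ.* factor    ∎) (P-sound y Py))

rigidity : ∀ {j k t m p y} .{{_ : NonZero j}} .{{_ : NonZero m}} →
           j ℕ.* k ≡ t ℕ.* m → t ℕ.* m ℕ.∣ p ℕ.* k ℕ.+ y ℕ.* m →
           Coprime p j → Coprime y t → j ≡ t × k ≡ m
rigidity {j} {k} {t} {m} {p} {y} jk≡tm tm∣pk+ym p⊥j y⊥t with j∣t
  where
  open ≡-Reasoning
  m∣pk : m ℕ.∣ p ℕ.* k
  m∣pk = ℕ.∣m+n∣m⇒∣n (subst (m ℕ.∣_) (ℕ.+-comm (p ℕ.* k) _) (ℕ.∣-trans (ℕ.n∣m*n t) tm∣pk+ym))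
                      (ℕ.n∣m*n y)
  j∣t : j ℕ.∣ t
  j∣t = Coprime.coprime-divisor (Coprime.sym p⊥j) (ℕ.*-cancelʳ-∣ m (subst (j ℕ.* m ℕ.∣_) (begin
    j ℕ.* (p ℕ.* k)  ≡⟨ ℕ.solve (j ∷ p ∷ k ∷ []) ⟩
    p ℕ.* (j ℕ.* k)  ≡⟨ cong (p ℕ.*_) jk≡tm ⟩
    p ℕ.* (t ℕ.* m)  ≡⟨ ℕ.solve (p ∷ t ∷ m ∷ []) ⟩
    p ℕ.* t ℕ.* m    ∎) (ℕ.*-monoʳ-∣ j m∣pk)))
... | ℕ.divides u refl = u≡1⇒ (y⊥t (u∣y , ℕ.m∣m*n j))
  where
  open ≡-Reasoning
  k≡um : k ≡ u ℕ.* m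
  k≡um = ℕ.*-cancelˡ-≡ k (u ℕ.* m) j (begin
    j ℕ.* k          ≡⟨ jk≡tm ⟩
    u ℕ.* j ℕ.* m    ≡⟨ ℕ.solve (u ∷ j ∷ m ∷ []) ⟩
    j ℕ.* (u ℕ.* m)  ∎)
  u∣y : u ℕ.∣ y
  u∣y = ℕ.∣m+n∣m⇒∣n (ℕ.∣-trans (ℕ.m∣m*n j) (ℕ.*-cancelʳ-∣ m (subst (u ℕ.* j ℕ.* m ℕ.∣_) (begin
    p ℕ.* k ℕ.+ y ℕ.* m          ≡⟨ cong (λ k → p ℕ.* k ℕ.+ y ℕ.* m) k≡um ⟩
    p ℕ.* (u ℕ.* m) ℕ.+ y ℕ.* m  ≡⟨ ℕ.solve (p ∷ u ∷ m ∷ y ∷ []) ⟩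
    (p ℕ.* u ℕ.+ y) ℕ.* m        ∎) tm∣pk+ym))) (ℕ.n∣m*n p)
  u≡1⇒ : u ≡ 1 → j ≡ u ℕ.* j × k ≡ m
  u≡1⇒ refl = sym (ℕ.*-identityˡ j) , trans k≡um (ℕ.*-identityˡ m)

belt-formula : ∀ {s b j d S} .{{_ : NonZero d}} → suc s ≡ j ℕ.* d → suc S ≡ j ℕ.* (b ℕ.+ 1) →
                   (hexes (s , b , 0) ℕ.∸ 2 ℕ.* S) / suc (2 ℕ.* S ℕ.+ 1) ℕ.+ 1 ≡ d
belt-formula {s} {b} {j} {suc d′} {S} N≡jd S+1≡jk =
  trans (ℕ.+-comm _ 1) (cong suc (trans (cong (_/ suc (2 ℕ.* S ℕ.+ 1)) hexes∸2S) (m*n/n≡m d′ _)))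
  where
  open ≡-Reasoning
  hexes+2 : hexes (s , b , 0) ℕ.+ 2 ≡ d′ ℕ.* suc (2 ℕ.* S ℕ.+ 1) ℕ.+ 2 ℕ.* S ℕ.+ 2
  hexes+2 = begin
    2 ℕ.* s ℕ.* b ℕ.+ 2 ℕ.* s ℕ.+ 2 ℕ.* b ℕ.+ 2 ≡⟨ ℕ.solve (s ∷ b ∷ []) ⟩
    2 ℕ.* (suc s ℕ.* (b ℕ.+ 1))      ≡⟨ cong (λ N → 2 ℕ.* (N ℕ.* (b ℕ.+ 1))) N≡jd ⟩
    2 ℕ.* (j ℕ.* suc d′ ℕ.* (b ℕ.+ 1)) ≡⟨ ℕ.solve (j ∷ d′ ∷ b ∷ []) ⟩
    2 ℕ.* (suc d′ ℕ.* (j ℕ.* (b ℕ.+ 1))) ≡⟨ cong (λ x → 2 ℕ.* (suc d′ ℕ.* x)) S+1≡jk ⟨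
    2 ℕ.* (suc d′ ℕ.* suc S)          ≡⟨ ℕ.solve (d′ ∷ S ∷ []) ⟩
    d′ ℕ.* suc (2 ℕ.* S ℕ.+ 1) ℕ.+ 2 ℕ.* S ℕ.+ 2 ∎
  hexes∸2S : hexes (s , b , 0) ℕ.∸ 2 ℕ.* S ≡ d′ ℕ.* suc (2 ℕ.* S ℕ.+ 1)
  hexes∸2S = trans (cong (ℕ._∸ 2 ℕ.* S) (ℕ.+-cancelʳ-≡ 2 _ _ hexes+2)) (ℕ.m+n∸n≡m _ (2 ℕ.* S))

negMod-spec : ∀ k x → suc k ℕ.∣ negMod k x ℕ.+ x
negMod-spec k x = ℕ.∣m+n∣m⇒∣n (subst (N ℕ.∣_) c+x≡ (ℕ.divides (suc (x / N)) c+x≡[1+x/N]N)) (ℕ.n∣m*n (c / N))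
  where
  open ≡-Reasoning
  N c : ℕ
  N = suc k
  c = N ℕ.∸ x % N
  c+x≡[1+x/N]N : c ℕ.+ x ≡ suc (x / N) ℕ.* N
  c+x≡[1+x/N]N = begin
    c ℕ.+ x                           ≡⟨ cong (c ℕ.+_) (m≡m%n+[m/n]*n x N) ⟩
    c ℕ.+ (x % N ℕ.+ x / N ℕ.* N)     ≡⟨ ℕ.+-assoc c (x % N) _ ⟨
    c ℕ.+ x % N ℕ.+ x / N ℕ.* N       ≡⟨ cong (ℕ._+ x / N ℕ.* N) (ℕ.m∸n+n≡m (m%n≤n x N)) ⟩
    N ℕ.+ x / N ℕ.* N                 ∎
  c+x≡ : c ℕ.+ x ≡ c / N ℕ.* N ℕ.+ (c % N ℕ.+ x)
  c+x≡ = begin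
    c ℕ.+ x                           ≡⟨ cong (ℕ._+ x) (trans (m≡m%n+[m/n]*n c N) (ℕ.+-comm (c % N) _)) ⟩
    c / N ℕ.* N ℕ.+ c % N ℕ.+ x       ≡⟨ ℕ.+-assoc (c / N ℕ.* N) (c % N) x ⟩
    c / N ℕ.* N ℕ.+ (c % N ℕ.+ x)     ∎

instance
  +1-nonZero : ∀ {b} → NonZero (b ℕ.+ 1)
  +1-nonZero {b} = subst NonZero (ℕ.+-comm 1 b) _

rotatedSpine : ℕ → ℕ → ℕ → ℕ
rotatedSpine s b a = order s a ℕ.* (b ℕ.+ 1) ℕ.∸ 1

rotatedBelt : ℕ → ℕ → ℕ → ℕ
rotatedBelt s b a = (hexes (s , b , 0) ℕ.∸ 2 ℕ.* rotatedSpine s b a) / suc (2 ℕ.* rotatedSpine s b a ℕ.+ 1)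

rotatedMultiplier : ℕ → ℕ → ℕ → ℕ
rotatedMultiplier s b a = leastPos (suc s) (λ p → ((p ℕ.* a) % suc s) ≡ᵇ ((rotatedBelt s b a ℕ.+ 1) % suc s))

rotatedOffset : ℕ → ℕ → ℕ → ℕ → ℕ
rotatedOffset s b a e =
  negMod (rotatedSpine s b a) (rotatedMultiplier s b a ℕ.* (b ℕ.+ 1) ℕ.+ e ℕ.* (rotatedBelt s b a ℕ.+ 1))

rotated : ℕ → ℕ → ℕ → ℕ → Signature
rotated s b a e = rotatedSpine s b a , rotatedBelt s b a , rotatedOffset s b a e

sig2≡rotated : ∀ s b f → sig2 (s , b , f) ≡ rotated s b f 1
sig2≡rotated s b f = cong (λ z → S , B , negMod S (rotatedMultiplier s b f ℕ.* (b ℕ.+ 1) ℕ.+ z))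
                          (sym (ℕ.*-identityˡ (B ℕ.+ 1)))
  where
  S B : ℕ
  S = rotatedSpine s b f
  B = rotatedBelt s b f

sig3≡rotated : ∀ s b f → sig3 (s , b , f) ≡ rotated s b (f ℕ.+ b ℕ.+ 1) 0
sig3≡rotated s b f = cong (λ z → S , rotatedBelt s b a , negMod S z)
                          (sym (ℕ.+-identityʳ (rotatedMultiplier s b a ℕ.* (b ℕ.+ 1))))
  where
  a S : ℕ
  a = f ℕ.+ b ℕ.+ 1
  S = rotatedSpine s b a

module _ {s a : ℕ} (b : ℕ) (L : LowestTerms a (suc s)) where
  open LowestTerms L
  private instance
    _ = den-nonZero L
    _ = factor-nonZero L

  rotatedSpine-suc : suc (rotatedSpine s b a) ≡ den ℕ.* (b ℕ.+ 1)
  rotatedSpine-suc = trans (cong (λ j → suc (j ℕ.* (b ℕ.+ 1) ℕ.∸ 1)) (order≡den s L))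
                           (ℕ.suc-pred (den ℕ.* (b ℕ.+ 1)) {{ℕ.m*n≢0 den (b ℕ.+ 1)}})

  rotatedBelt+1 : rotatedBelt s b a ℕ.+ 1 ≡ factor
  rotatedBelt+1 = belt-formula {j = den} n≡den*factor rotatedSpine-suc

  rotatedOffset-spec : ∀ e → suc (rotatedSpine s b a) ℕ.∣
                       rotatedOffset s b a e ℕ.+ (rotatedMultiplier s b a ℕ.* (b ℕ.+ 1) ℕ.+ e ℕ.* factor)
  rotatedOffset-spec e = subst (λ d → suc S ℕ.∣ rotatedOffset s b a e ℕ.+ (pk ℕ.+ e ℕ.* d)) rotatedBelt+1
                                (negMod-spec S (pk ℕ.+ e ℕ.* (rotatedBelt s b a ℕ.+ 1)))
    where
    S pk : ℕ
    S = rotatedSpine s b a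
    pk = rotatedMultiplier s b a ℕ.* (b ℕ.+ 1)

cubeRootSignature : ℕ → ℕ → ℕ → Signature
cubeRootSignature t m g = t ℕ.* m ℕ.∸ 1 , m ℕ.∸ 1 , g ℕ.* m

HasCubeRootSignature : Signature → Set
HasCubeRootSignature σ = Σ ℕ λ t → Σ ℕ λ m → Σ ℕ λ g →
  1 ℕ.≤ t × 1 ℕ.≤ m × g ℕ.< t × t ℕ.∣ g ℕ.* g ℕ.+ g ℕ.+ 1 × IsEquivSig σ (cubeRootSignature t m g)

module _ where
  open import Data.Integer using (ℤ; +_; -_; _+_; _-_; _*_; 1ℤ; _%ℕ_; _/ℕ_)
  import Data.Integer.Properties as ℤ
  open import Data.Integer.DivMod using (a≡a%ℕn+[a/ℕn]*n; n%ℕd<d)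
  open import Data.Integer.Divisibility.Signed
    using (_∣_; divides; ∣ᵤ⇒∣; ∣⇒∣ᵤ; ∣-trans; ∣m∣n⇒∣m+n; ∣m+n∣m⇒∣n; ∣m⇒∣-m; ∣n⇒∣m*n;
           *-monoˡ-∣; *-cancelʳ-∣)
  open import Data.Integer.Tactic.RingSolver using (solve)

  ∣-linear : ∀ {n x y z} → n ∣ x → n ∣ y → (u v : ℤ) → z ≡ u * x + v * y → n ∣ z
  ∣-linear n∣x n∣y u v refl = ∣m∣n⇒∣m+n (∣n⇒∣m*n u n∣x) (∣n⇒∣m*n v n∣y)

  ∣-multiple : ∀ {n x y} → n ∣ x → (u : ℤ) → y ≡ u * x → n ∣ y
  ∣-multiple n∣x u refl = ∣n⇒∣m*n u n∣x

  ∣-swap : ∀ {n} x y → n ∣ x - y → n ∣ y - x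
  ∣-swap x y n∣x-y = ∣-multiple n∣x-y (- 1ℤ) (solve (x ∷ y ∷ []))

  ∣xy+1∧∣px-1⇒∣p+y : ∀ {n} x y p → n ∣ x * y + 1ℤ → n ∣ p * x - 1ℤ → n ∣ p + y
  ∣xy+1∧∣px-1⇒∣p+y x y p n∣xy+1 n∣px-1 =
    ∣-linear n∣xy+1 n∣px-1 p (- y) (solve (x ∷ y ∷ p ∷ []))

  ∣xy+1∧∣p+y∧∣pa-1⇒∣a-x : ∀ {n} x y p a → n ∣ x * y + 1ℤ → n ∣ p + y → n ∣ p * a - 1ℤ → n ∣ a - x
  ∣xy+1∧∣p+y∧∣pa-1⇒∣a-x x y p a n∣xy+1 n∣p+y n∣pa-1 =
    ∣-linear (∣-linear n∣xy+1 n∣p+y a (- (x * a)) refl) n∣pa-1 1ℤ x (solve (x ∷ y ∷ p ∷ a ∷ []))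

  ∣a+p+1∧∣pa-1⇒∣aa+a+1 : ∀ {n} a p → n ∣ a + p + 1ℤ → n ∣ p * a - 1ℤ → n ∣ a * a + a + 1ℤ
  ∣a+p+1∧∣pa-1⇒∣aa+a+1 a p n∣a+p+1 n∣pa-1 =
    ∣-linear n∣a+p+1 n∣pa-1 a (- 1ℤ) (solve (a ∷ p ∷ []))

  ∣ux-1⇒coprime : ∀ {n x} u → + n ∣ u * + x - 1ℤ → Coprime x n
  ∣ux-1⇒coprime u n∣ux-1 {c} (c∣x , c∣n) = ℕ.∣1⇒≡1 (∣⇒∣ᵤ (∣m⇒∣-m
    (∣m+n∣m⇒∣n (∣-trans (∣ᵤ⇒∣ {+ c} c∣n) n∣ux-1) (∣n⇒∣m*n u (∣ᵤ⇒∣ {+ c} c∣x)))))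

  ∣xy+1⇒coprime : ∀ {n} x y → + n ∣ + x * + y + 1ℤ → Coprime x n × Coprime y n
  ∣xy+1⇒coprime x y n∣xy+1 =
    ∣ux-1⇒coprime (- + y) (∣-multiple n∣xy+1 (- 1ℤ) (negate₁ (+ x) (+ y))) ,
    ∣ux-1⇒coprime (- + x) (∣-multiple n∣xy+1 (- 1ℤ) (negate₂ (+ x) (+ y)))
    where
    negate₁ : ∀ X Y → (- Y) * X - 1ℤ ≡ - 1ℤ * (X * Y + 1ℤ)
    negate₁ X Y = solve (X ∷ Y ∷ [])
    negate₂ : ∀ X Y → (- X) * Y - 1ℤ ≡ - 1ℤ * (X * Y + 1ℤ)
    negate₂ X Y = solve (X ∷ Y ∷ [])

  ∣a+c∧∣b+c⇒∣a-b : ∀ {n} a b c → n ∣ a + c → n ∣ b + c → n ∣ a - b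
  ∣a+c∧∣b+c⇒∣a-b a b c n∣a+c n∣b+c = ∣-linear n∣a+c n∣b+c 1ℤ (- 1ℤ) (solve (a ∷ b ∷ c ∷ []))

  x%n≡y%n⇒n∣x-y : ∀ {n x y} .{{_ : NonZero n}} → x % n ≡ y % n → + n ∣ + x - + y
  x%n≡y%n⇒n∣x-y {n} {x} {y} x%n≡y%n = divides (+ (x / n) - + (y / n)) (begin
    + x - + y                                                     ≡⟨ cong₂ _-_ (split x) (split y) ⟩
    (+ (x % n) + + (x / n) * + n) - (+ (y % n) + + (y / n) * + n)
      ≡⟨ cancel _ _ (+ (x / n)) (+ (y / n)) (+ n) (cong +_ x%n≡y%n) ⟩
    (+ (x / n) - + (y / n)) * + n                                 ∎)
    where
    open ≡-Reasoning
    split : ∀ z → + z ≡ + (z % n) + + (z / n) * + n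
    split z = trans (cong +_ (m≡m%n+[m/n]*n z n)) (cong (λ q → + (z % n) + q) (ℤ.pos-* (z / n) n))
    cancel : ∀ r r′ a b m → r ≡ r′ → (r + a * m) - (r′ + b * m) ≡ (a - b) * m
    cancel r _ a b m refl = solve (r ∷ a ∷ b ∷ m ∷ [])

  private
    n∣x-y⇒x%n≡y%n-≤ : ∀ {n x y} .{{_ : NonZero n}} → y ℕ.≤ x → + n ∣ + x - + y → x % n ≡ y % n
    n∣x-y⇒x%n≡y%n-≤ {n} {x} {y} y≤x n∣x-y
      with ∣⇒∣ᵤ (subst (+ n ∣_) (trans (ℤ.m-n≡m⊖n x y) (ℤ.⊖-≥ y≤x)) n∣x-y)
    ... | ℕ.divides q x∸y≡qn = begin
      x % n                  ≡⟨ cong (_% n) (ℕ.m+[n∸m]≡n y≤x) ⟨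
      (y ℕ.+ (x ℕ.∸ y)) % n  ≡⟨ cong (λ z → (y ℕ.+ z) % n) x∸y≡qn ⟩
      (y ℕ.+ q ℕ.* n) % n    ≡⟨ [m+kn]%n≡m%n y q n ⟩
      y % n                  ∎
      where open ≡-Reasoning

  n∣x-y⇒x%n≡y%n : ∀ {n x y} .{{_ : NonZero n}} → + n ∣ + x - + y → x % n ≡ y % n
  n∣x-y⇒x%n≡y%n {n} {x} {y} n∣x-y with ℕ.≤-total y x
  ... | inj₁ y≤x = n∣x-y⇒x%n≡y%n-≤ {n} y≤x n∣x-y
  ... | inj₂ x≤y = sym (n∣x-y⇒x%n≡y%n-≤ {n} x≤y (∣-swap (+ x) (+ y) n∣x-y))

  n∣x-y⇒x≡y : ∀ {n x y} → x ℕ.< n → y ℕ.< n → + n ∣ + x - + y → x ≡ y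
  n∣x-y⇒x≡y {suc n} {x} {y} x<n y<n n∣x-y = begin
    x          ≡⟨ m<n⇒m%n≡m x<n ⟨
    x % suc n  ≡⟨ n∣x-y⇒x%n≡y%n {suc n} {x} {y} n∣x-y ⟩
    y % suc n  ≡⟨ m<n⇒m%n≡m y<n ⟩
    y          ∎
    where open ≡-Reasoning

  private
    pos-1+*≡* : ∀ p q r s → 1 ℕ.+ p ℕ.* q ≡ r ℕ.* s → 1ℤ + + p * + q ≡ + r * + s
    pos-1+*≡* p q r s eq = trans (cong (λ z → 1ℤ + z) (sym (ℤ.pos-* p q))) (trans (cong +_ eq) (ℤ.pos-* r s))

  coprime⇒inverse : ∀ {a n} → Coprime a n → Σ ℤ λ u → + n ∣ u * + a - 1ℤ
  coprime⇒inverse {a} {n} a⊥n with Coprime.coprime-Bézout a⊥n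
  ... | Bézout.+- x y 1+yn≡xa = + x , divides (+ y) (xa-1≡yn (+ x) (+ a) (+ y) (+ n) (pos-1+*≡* y n x a 1+yn≡xa))
    where
    xa-1≡yn : ∀ X A Y N → 1ℤ + Y * N ≡ X * A → X * A - 1ℤ ≡ Y * N
    xa-1≡yn X A Y N eq = trans (cong (_- 1ℤ) (sym eq)) (solve (Y ∷ N ∷ []))
  ... | Bézout.-+ x y 1+xa≡yn = - + x , divides (- + y) ([-x]a-1≡[-y]n (+ x) (+ a) (+ y) (+ n) (pos-1+*≡* x a y n 1+xa≡yn))
    where
    [-x]a-1≡[-y]n : ∀ X A Y N → 1ℤ + X * A ≡ Y * N → (- X) * A - 1ℤ ≡ (- Y) * N
    [-x]a-1≡[-y]n X A Y N eq = begin
      (- X) * A - 1ℤ  ≡⟨ solve (X ∷ A ∷ []) ⟩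
      - (1ℤ + X * A)  ≡⟨ cong -_ eq ⟩
      - (Y * N)       ≡⟨ solve (Y ∷ N ∷ []) ⟩
      (- Y) * N       ∎
      where open ≡-Reasoning

  ∣p-u∧∣ua-1⇒∣pa-1 : ∀ {n} p u a → n ∣ p - u → n ∣ u * a - 1ℤ → n ∣ p * a - 1ℤ
  ∣p-u∧∣ua-1⇒∣pa-1 p u a n∣p-u n∣ua-1 = ∣-linear n∣p-u n∣ua-1 a 1ℤ (solve (p ∷ u ∷ a ∷ []))

  positive-representative : ∀ u n .{{_ : NonZero n}} → Σ ℕ λ p → 1 ℕ.≤ p × p ℕ.≤ n × + n ∣ + p - u
  positive-representative u n =
    suc r , ℕ.s≤s ℕ.z≤n , n%ℕd<d (u - 1ℤ) n , divides (- q) (shift u (+ r) q (+ n) (a≡a%ℕn+[a/ℕn]*n (u - 1ℤ) n))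
    where
    r : ℕ
    r = (u - 1ℤ) %ℕ n
    q : ℤ
    q = (u - 1ℤ) /ℕ n
    shift : ∀ U R Q N → U - 1ℤ ≡ R + Q * N → (1ℤ + R) - U ≡ (- Q) * N
    shift U R Q N eq = begin
      (1ℤ + R) - U     ≡⟨ solve (U ∷ R ∷ []) ⟩
      R - (U - 1ℤ)     ≡⟨ cong (λ z → R - z) eq ⟩
      R - (R + Q * N)  ≡⟨ solve (R ∷ Q ∷ N ∷ []) ⟩
      (- Q) * N        ∎
      where open ≡-Reasoning

  coprime⇒positive-inverse : ∀ {a n} .{{_ : NonZero n}} → Coprime a n →
                             Σ ℕ λ p → 1 ℕ.≤ p × p ℕ.≤ n × + n ∣ + p * + a - 1ℤ
  coprime⇒positive-inverse {a} {n} a⊥n with coprime⇒inverse a⊥n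
  ... | u , n∣ua-1 with positive-representative u n
  ... | p , 1≤p , p≤n , n∣p-u = p , 1≤p , p≤n , ∣p-u∧∣ua-1⇒∣pa-1 (+ p) u (+ a) n∣p-u n∣ua-1

  leastPos-inverse : ∀ {s a} (L : LowestTerms a (suc s)) →
    + LowestTerms.den L ∣
      + leastPos (suc s) (λ p → ((p ℕ.* a) % suc s) ≡ᵇ (LowestTerms.factor L % suc s)) * + LowestTerms.num L - 1ℤ
  leastPos-inverse {s} {a} L@(lowest num den d a≡num*d N≡den*d num⊥den) =
    let p₀ , 1≤p₀ , p₀≤den , den∣p₀num-1 = coprime⇒positive-inverse {{den-nonZero L}} num⊥den
    in P⇒∣ (leastPos N P)
           (search-sound N 1 P 1≤p₀ (ℕ.s≤s (ℕ.≤-trans p₀≤den (den≤n L))) (∣⇒P p₀ den∣p₀num-1))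
    where
    instance
      _ = factor-nonZero L
    N : ℕ
    N = suc s
    P : ℕ → Bool
    P p = ((p ℕ.* a) % N) ≡ᵇ (d % N)
    +N≡+den*+d : + N ≡ + den * + d
    +N≡+den*+d = trans (cong +_ N≡den*d) (ℤ.pos-* den d)
    pa-d≡[pnum-1]d : ∀ p → + (p ℕ.* a) - + d ≡ (+ p * + num - 1ℤ) * + d
    pa-d≡[pnum-1]d p = begin
      + (p ℕ.* a) - + d               ≡⟨ cong (λ z → + (p ℕ.* z) - + d) a≡num*d ⟩
      + (p ℕ.* (num ℕ.* d)) - + d     ≡⟨ cong (_- + d) (trans (ℤ.pos-* p _) (cong (+ p *_) (ℤ.pos-* num d))) ⟩
      + p * (+ num * + d) - + d       ≡⟨ regroup (+ p) (+ num) (+ d) ⟩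
      (+ p * + num - 1ℤ) * + d        ∎
      where
      open ≡-Reasoning
      regroup : ∀ P A D → P * (A * D) - D ≡ (P * A - 1ℤ) * D
      regroup P A D = solve (P ∷ A ∷ D ∷ [])
    P⇒∣ : ∀ p → T (P p) → + den ∣ + p * + num - 1ℤ
    P⇒∣ p Pp = *-cancelʳ-∣ (+ d) (subst₂ _∣_ +N≡+den*+d (pa-d≡[pnum-1]d p)
      (x%n≡y%n⇒n∣x-y {N} {p ℕ.* a} {d} (ℕ.≡ᵇ⇒≡ ((p ℕ.* a) % N) (d % N) Pp)))
    ∣⇒P : ∀ p → + den ∣ + p * + num - 1ℤ → T (P p)
    ∣⇒P p den∣pnum-1 = ℕ.≡⇒≡ᵇ ((p ℕ.* a) % N) (d % N)
      (n∣x-y⇒x%n≡y%n {N} {p ℕ.* a} {d}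
        (subst₂ _∣_ (sym +N≡+den*+d) (sym (pa-d≡[pnum-1]d p)) (*-monoˡ-∣ (+ d) den∣pnum-1)))

  rotatedMultiplier-inverse : ∀ {s a} b (L : LowestTerms a (suc s)) →
    + LowestTerms.den L ∣ + rotatedMultiplier s b a * + LowestTerms.num L - 1ℤ
  rotatedMultiplier-inverse {s} {a} b L@(lowest num den _ _ _ _) = subst
    (λ r → + den ∣ + leastPos (suc s) (λ p → ((p ℕ.* a) % suc s) ≡ᵇ (r % suc s)) * + num - 1ℤ)
    (sym (rotatedBelt+1 b L)) (leastPos-inverse L)

  negMod-unique : ∀ {k x y} → y ℕ.< suc k → suc k ℕ.∣ y ℕ.+ x → negMod k x ≡ y
  negMod-unique {k} {x} {y} y<N N∣y+x = n∣x-y⇒x≡y (m%n<n (suc k ℕ.∸ x % suc k) (suc k)) y<N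
    (∣a+c∧∣b+c⇒∣a-b (+ negMod k x) (+ y) (+ x) (∣ᵤ⇒∣ (negMod-spec k x)) (∣ᵤ⇒∣ N∣y+x))

  rotatedOffset-unique : ∀ {s a} b (L : LowestTerms a (suc s)) e {y} → y ℕ.< suc (rotatedSpine s b a) →
    suc (rotatedSpine s b a) ℕ.∣ y ℕ.+ (rotatedMultiplier s b a ℕ.* (b ℕ.+ 1) ℕ.+ e ℕ.* LowestTerms.factor L) →
    rotatedOffset s b a e ≡ y
  rotatedOffset-unique {s} {a} b L e {y} y<N N∣ = negMod-unique y<N (subst
    (λ d → suc (rotatedSpine s b a) ℕ.∣ y ℕ.+ (rotatedMultiplier s b a ℕ.* (b ℕ.+ 1) ℕ.+ e ℕ.* d))
    (sym (rotatedBelt+1 b L)) N∣)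

  rotated-fixed : ∀ {s b e t m g x y} → suc s ≡ t ℕ.* m → b ℕ.+ 1 ≡ m → g ℕ.< t → y ≡ g ℕ.+ e →
                  + t ∣ + x * + y + 1ℤ → rotated s b (x ℕ.* m) e ≡ (s , b , g ℕ.* m)
  rotated-fixed {s} {b} {e} {t} {m} {g} {x} {y} N≡tm refl g<t refl t∣xy+1 =
    cong₂ _,_ (ℕ.suc-injective (trans spine (sym N≡tm)))
      (cong₂ _,_ (ℕ.+-cancelʳ-≡ 1 _ b (rotatedBelt+1 b L))
        (rotatedOffset-unique b L e (subst (g ℕ.* m ℕ.<_) (sym spine) (ℕ.*-monoˡ-< m g<t))
          (subst₂ ℕ._∣_ (sym spine) (regroup p g e m) (ℕ.*-monoˡ-∣ m t∣p+y))))
    where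
    L : LowestTerms (x ℕ.* m) (suc s)
    L = lowest x t m refl N≡tm (proj₁ (∣xy+1⇒coprime x y t∣xy+1))
    p : ℕ
    p = rotatedMultiplier s b (x ℕ.* m)
    spine : suc (rotatedSpine s b (x ℕ.* m)) ≡ t ℕ.* m
    spine = rotatedSpine-suc b L
    t∣p+y : t ℕ.∣ p ℕ.+ y
    t∣p+y = ∣⇒∣ᵤ (∣xy+1∧∣px-1⇒∣p+y (+ x) (+ y) (+ p) t∣xy+1 (rotatedMultiplier-inverse b L))
    regroup : ∀ p g e m → (p ℕ.+ (g ℕ.+ e)) ℕ.* m ≡ g ℕ.* m ℕ.+ (p ℕ.* m ℕ.+ e ℕ.* m)
    regroup p g e m = ℕ.solve (p ∷ g ∷ e ∷ m ∷ [])

  rotation-rigidity : ∀ {j k t m p a′ x y} .{{_ : NonZero j}} .{{_ : NonZero m}} →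
    j ℕ.* k ≡ t ℕ.* m → t ℕ.* m ℕ.∣ p ℕ.* k ℕ.+ y ℕ.* m →
    + j ∣ + p * + a′ - 1ℤ → + t ∣ + x * + y + 1ℤ →
    j ≡ t × k ≡ m × + t ∣ + a′ - + x
  rotation-rigidity {j} {k} {t} {m} {p} {a′} {x} {y} jk≡tm tm∣pk+ym j∣pa′-1 t∣xy+1 =
    j≡t , k≡m , ∣xy+1∧∣p+y∧∣pa-1⇒∣a-x (+ x) (+ y) (+ p) (+ a′) t∣xy+1 t∣p+y
                  (subst (λ j → + j ∣ + p * + a′ - 1ℤ) j≡t j∣pa′-1)
    where
    open ≡-Reasoning
    j≡t×k≡m : j ≡ t × k ≡ m
    j≡t×k≡m = rigidity jk≡tm tm∣pk+ym
      (∣ux-1⇒coprime (+ a′) (subst (λ z → + j ∣ z - 1ℤ) (ℤ.*-comm (+ p) (+ a′)) j∣pa′-1))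
      (proj₂ (∣xy+1⇒coprime x y t∣xy+1))
    j≡t : j ≡ t
    j≡t = proj₁ j≡t×k≡m
    k≡m : k ≡ m
    k≡m = proj₂ j≡t×k≡m
    t∣p+y : + t ∣ + p + + y
    t∣p+y = ∣ᵤ⇒∣ (ℕ.*-cancelʳ-∣ m (subst (t ℕ.* m ℕ.∣_) (begin
      p ℕ.* k ℕ.+ y ℕ.* m  ≡⟨ cong (λ k → p ℕ.* k ℕ.+ y ℕ.* m) k≡m ⟩
      p ℕ.* m ℕ.+ y ℕ.* m  ≡⟨ ℕ.*-distribʳ-+ m p y ⟨
      (p ℕ.+ y) ℕ.* m      ∎) tm∣pk+ym))

  rotated-preimage : ∀ {s b a e t m g x y} .{{_ : NonZero t}} .{{_ : NonZero m}} → y ≡ g ℕ.+ e →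
    + t ∣ + x * + y + 1ℤ → rotated s b a e ≡ cubeRootSignature t m g →
    suc s ≡ t ℕ.* m × b ℕ.+ 1 ≡ m × + (t ℕ.* m) ∣ + a - + (x ℕ.* m)
  rotated-preimage {s} {b} {a} {e} {t} {m} {g} {x} {y} refl t∣xy+1 rotated≡τ = go (lowestTerms a (suc s))
    where
    open ≡-Reasoning
    go : LowestTerms a (suc s) → suc s ≡ t ℕ.* m × b ℕ.+ 1 ≡ m × + (t ℕ.* m) ∣ + a - + (x ℕ.* m)
    go L@(lowest a′ j d a≡a′d N≡jd _) =
      let j≡t , k≡m , t∣a′-x = rotation-rigidity {j} {b ℕ.+ 1} {t} {m} {p} {a′} {x} {y} {{den-nonZero L}}
                                 jk≡tm tm∣pk+ym (rotatedMultiplier-inverse b L) t∣xy+1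
      in trans N≡jd (cong₂ ℕ._*_ j≡t d≡m) , k≡m ,
         subst₂ _∣_ (sym (ℤ.pos-* t m)) a′m-xm (*-monoˡ-∣ (+ m) t∣a′-x)
      where
      p : ℕ
      p = rotatedMultiplier s b a
      1+S≡tm : suc (rotatedSpine s b a) ≡ t ℕ.* m
      1+S≡tm = trans (cong suc (,-injectiveˡ rotated≡τ)) (ℕ.suc-pred (t ℕ.* m) {{ℕ.m*n≢0 t m}})
      jk≡tm : j ℕ.* (b ℕ.+ 1) ≡ t ℕ.* m
      jk≡tm = trans (sym (rotatedSpine-suc b L)) 1+S≡tm
      d≡m : d ≡ m
      d≡m = trans (sym (rotatedBelt+1 b L))
                  (trans (cong (ℕ._+ 1) (,-injectiveˡ (,-injectiveʳ rotated≡τ))) (ℕ.m∸n+n≡m (ℕ.>-nonZero⁻¹ m)))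
      regroup : ∀ g p e k m → g ℕ.* m ℕ.+ (p ℕ.* k ℕ.+ e ℕ.* m) ≡ p ℕ.* k ℕ.+ (g ℕ.+ e) ℕ.* m
      regroup g p e k m = ℕ.solve (g ∷ p ∷ e ∷ k ∷ m ∷ [])
      tm∣pk+ym : t ℕ.* m ℕ.∣ p ℕ.* (b ℕ.+ 1) ℕ.+ y ℕ.* m
      tm∣pk+ym = subst₂ ℕ._∣_ 1+S≡tm (begin
        rotatedOffset s b a e ℕ.+ (p ℕ.* (b ℕ.+ 1) ℕ.+ e ℕ.* d)  ≡⟨ cong₂ (λ f d → f ℕ.+ (p ℕ.* (b ℕ.+ 1) ℕ.+ e ℕ.* d))
                                                                        (,-injectiveʳ (,-injectiveʳ rotated≡τ)) d≡m ⟩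
        g ℕ.* m ℕ.+ (p ℕ.* (b ℕ.+ 1) ℕ.+ e ℕ.* m)                ≡⟨ regroup g p e (b ℕ.+ 1) m ⟩
        p ℕ.* (b ℕ.+ 1) ℕ.+ y ℕ.* m                              ∎) (rotatedOffset-spec b L e)
      factor-out : ∀ A X M → A * M - X * M ≡ (A - X) * M
      factor-out A X M = solve (A ∷ X ∷ M ∷ [])
      a′m-xm : (+ a′ - + x) * + m ≡ + a - + (x ℕ.* m)
      a′m-xm = begin
        (+ a′ - + x) * + m            ≡⟨ factor-out (+ a′) (+ x) (+ m) ⟨
        + a′ * + m - + x * + m        ≡⟨ cong₂ _-_ (ℤ.pos-* a′ m) (ℤ.pos-* x m) ⟨
        + (a′ ℕ.* m) - + (x ℕ.* m)    ≡⟨ cong (λ z → + z - + (x ℕ.* m)) (trans a≡a′d (cong (a′ ℕ.*_) d≡m)) ⟨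
        + a - + (x ℕ.* m)             ∎

  sig2-fixed⇒cubeRoot : ∀ {s b f} → f ℕ.≤ s → sig2 (s , b , f) ≡ (s , b , f) → HasCubeRootSignature (s , b , f)
  sig2-fixed⇒cubeRoot {s} {b} {f} f≤s sig2≡σ = go (lowestTerms f (suc s))
    where
    open ≡-Reasoning
    fixed : rotated s b f 1 ≡ (s , b , f)
    fixed = trans (sym (sig2≡rotated s b f)) sig2≡σ
    go : LowestTerms f (suc s) → HasCubeRootSignature (s , b , f)
    go L@(lowest g t m f≡gm N≡tm _) =
      t , m , g , ℕ.>-nonZero⁻¹ t , ℕ.>-nonZero⁻¹ m , g<t , t∣gg+g+1 , inj₁ τ≡σ
      where
      instance
        _ = den-nonZero L
        _ = factor-nonZero L
      p : ℕ
      p = rotatedMultiplier s b f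
      m≡k : m ≡ b ℕ.+ 1
      m≡k = trans (sym (rotatedBelt+1 b L)) (cong (ℕ._+ 1) (,-injectiveˡ (,-injectiveʳ fixed)))
      regroup : ∀ g p m → g ℕ.* m ℕ.+ (p ℕ.* m ℕ.+ 1 ℕ.* m) ≡ (g ℕ.+ p ℕ.+ 1) ℕ.* m
      regroup g p m = ℕ.solve (g ∷ p ∷ m ∷ [])
      tm∣[g+p+1]m : t ℕ.* m ℕ.∣ (g ℕ.+ p ℕ.+ 1) ℕ.* m
      tm∣[g+p+1]m = subst₂ ℕ._∣_ (trans (cong suc (,-injectiveˡ fixed)) N≡tm) (begin
        rotatedOffset s b f 1 ℕ.+ (p ℕ.* (b ℕ.+ 1) ℕ.+ 1 ℕ.* m)  ≡⟨ cong₂ (λ f k → f ℕ.+ (p ℕ.* k ℕ.+ 1 ℕ.* m))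
                                                                        (trans (,-injectiveʳ (,-injectiveʳ fixed)) f≡gm) (sym m≡k) ⟩
        g ℕ.* m ℕ.+ (p ℕ.* m ℕ.+ 1 ℕ.* m)                        ≡⟨ regroup g p m ⟩
        (g ℕ.+ p ℕ.+ 1) ℕ.* m                                    ∎) (rotatedOffset-spec b L 1)
      t∣gg+g+1 : t ℕ.∣ g ℕ.* g ℕ.+ g ℕ.+ 1
      t∣gg+g+1 = ∣⇒∣ᵤ (subst (+ t ∣_) (cong (λ z → z + + g + 1ℤ) (sym (ℤ.pos-* g g)))
        (∣a+p+1∧∣pa-1⇒∣aa+a+1 (+ g) (+ p) (∣ᵤ⇒∣ (ℕ.*-cancelʳ-∣ m tm∣[g+p+1]m))
                               (rotatedMultiplier-inverse b L)))
      g<t : g ℕ.< t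
      g<t = ℕ.*-cancelʳ-< m g t (subst₂ ℕ._<_ f≡gm N≡tm (ℕ.s≤s f≤s))
      τ≡σ : cubeRootSignature t m g ≡ (s , b , f)
      τ≡σ = cong₂ _,_ (cong ℕ.pred (sym N≡tm)) (cong₂ _,_ (trans (cong ℕ.pred m≡k) (ℕ.m+n∸n≡m b 1)) (sym f≡gm))

  cubeRoot-units : ∀ {t g} → t ℕ.∣ g ℕ.* g ℕ.+ g ℕ.+ 1 →
                   + t ∣ + g * + (g ℕ.+ 1) + 1ℤ × + t ∣ + (g ℕ.+ 1) * + g + 1ℤ
  cubeRoot-units {t} {g} t∣gg+g+1 =
    subst (+ t ∣_) (cast g (g ℕ.+ 1) (ℕ.solve (g ∷ []))) (∣ᵤ⇒∣ t∣gg+g+1) ,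
    subst (+ t ∣_) (cast (g ℕ.+ 1) g (ℕ.solve (g ∷ []))) (∣ᵤ⇒∣ t∣gg+g+1)
    where
    cast : ∀ x y → g ℕ.* g ℕ.+ g ≡ x ℕ.* y → + (g ℕ.* g ℕ.+ g ℕ.+ 1) ≡ + x * + y + 1ℤ
    cast x y eq = cong (_+ 1ℤ) (trans (cong +_ eq) (ℤ.pos-* x y))

  cubeRootSignature-coinciding : ∀ {t m g} → 1 ℕ.≤ t → 1 ℕ.≤ m → g ℕ.< t → t ℕ.∣ g ℕ.* g ℕ.+ g ℕ.+ 1 →
                                 CoincidingSignatures (cubeRootSignature t m g)
  cubeRootSignature-coinciding {t} {m} {g} 1≤t 1≤m g<t t∣gg+g+1 =
    trans (sig2≡rotated s′ b′ (g ℕ.* m))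
      (rotated-fixed {e = 1} {x = g} N≡tm k≡m g<t refl g[g+1]≡-1) ,
    trans (sig3≡rotated s′ b′ (g ℕ.* m)) (trans (cong (λ a → rotated s′ b′ a 0) a≡[g+1]m)
      (rotated-fixed {e = 0} {x = g ℕ.+ 1} N≡tm k≡m g<t (sym (ℕ.+-identityʳ g)) [g+1]g≡-1))
    where
    s′ b′ : ℕ
    s′ = t ℕ.* m ℕ.∸ 1
    b′ = m ℕ.∸ 1
    g[g+1]≡-1 : + t ∣ + g * + (g ℕ.+ 1) + 1ℤ
    g[g+1]≡-1 = proj₁ (cubeRoot-units {t} {g} t∣gg+g+1)
    [g+1]g≡-1 : + t ∣ + (g ℕ.+ 1) * + g + 1ℤ
    [g+1]g≡-1 = proj₂ (cubeRoot-units {t} {g} t∣gg+g+1)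
    N≡tm : suc s′ ≡ t ℕ.* m
    N≡tm = ℕ.suc-pred (t ℕ.* m) {{ℕ.m*n≢0 t m {{ℕ.>-nonZero 1≤t}} {{ℕ.>-nonZero 1≤m}}}}
    k≡m : b′ ℕ.+ 1 ≡ m
    k≡m = ℕ.m∸n+n≡m 1≤m
    a≡[g+1]m : g ℕ.* m ℕ.+ b′ ℕ.+ 1 ≡ (g ℕ.+ 1) ℕ.* m
    a≡[g+1]m = trans (ℕ.+-assoc (g ℕ.* m) b′ 1) (trans (cong (g ℕ.* m ℕ.+_) k≡m) (ℕ.solve (g ∷ m ∷ [])))

  ≡cubeRootSignature : ∀ {s b f t m g} .{{_ : NonZero m}} → f ℕ.≤ s → g ℕ.< t →
    suc s ≡ t ℕ.* m → b ℕ.+ 1 ≡ m → + (t ℕ.* m) ∣ + f - + (g ℕ.* m) → (s , b , f) ≡ cubeRootSignature t m g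
  ≡cubeRootSignature {s} {b} {f} {t} {m} {g} f≤s g<t N≡tm k≡m tm∣f-gm =
    cong₂ _,_ (cong ℕ.pred N≡tm) (cong₂ _,_ (trans (sym (ℕ.m+n∸n≡m b 1)) (cong ℕ.pred k≡m))
      (n∣x-y⇒x≡y (subst (f ℕ.<_) N≡tm (ℕ.s≤s f≤s)) (ℕ.*-monoˡ-< m g<t) tm∣f-gm))

  sig2-reflects-cubeRoot : ∀ {s b f t m g} → f ℕ.≤ s →
    1 ℕ.≤ t → 1 ℕ.≤ m → g ℕ.< t → t ℕ.∣ g ℕ.* g ℕ.+ g ℕ.+ 1 →
    sig2 (s , b , f) ≡ cubeRootSignature t m g → (s , b , f) ≡ cubeRootSignature t m g
  sig2-reflects-cubeRoot {s} {b} {f} {t} {m} {g} f≤s 1≤t 1≤m g<t t∣gg+g+1 sig2≡τ =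
    let N≡tm , k≡m , tm∣f-gm = rotated-preimage {e = 1} {g = g} {x = g} refl (proj₁ (cubeRoot-units {t} {g} t∣gg+g+1))
                                  (trans (sym (sig2≡rotated s b f)) sig2≡τ)
    in ≡cubeRootSignature f≤s g<t N≡tm k≡m tm∣f-gm
    where
    instance
      _ = ℕ.>-nonZero 1≤t
      _ = ℕ.>-nonZero 1≤m

  sig3-reflects-cubeRoot : ∀ {s b f t m g} → f ℕ.≤ s →
    1 ℕ.≤ t → 1 ℕ.≤ m → g ℕ.< t → t ℕ.∣ g ℕ.* g ℕ.+ g ℕ.+ 1 →
    sig3 (s , b , f) ≡ cubeRootSignature t m g → (s , b , f) ≡ cubeRootSignature t m g
  sig3-reflects-cubeRoot {s} {b} {f} {t} {m} {g} f≤s 1≤t 1≤m g<t t∣gg+g+1 sig3≡τ =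
    let N≡tm , k≡m , tm∣a-[g+1]m = rotated-preimage {e = 0} {g = g} {x = g ℕ.+ 1} (sym (ℕ.+-identityʳ g))
                                      (proj₂ (cubeRoot-units {t} {g} t∣gg+g+1)) (trans (sym (sig3≡rotated s b f)) sig3≡τ)
    in ≡cubeRootSignature f≤s g<t N≡tm k≡m (subst (+ (t ℕ.* m) ∣_) (a-[g+1]m≡f-gm k≡m) tm∣a-[g+1]m)
    where
    open ≡-Reasoning
    instance
      _ = ℕ.>-nonZero 1≤t
      _ = ℕ.>-nonZero 1≤m
    cancel : ∀ F G M → (F + M) - (G + M) ≡ F - G
    cancel F G M = solve (F ∷ G ∷ M ∷ [])
    [g+1]m≡gm+m : (g ℕ.+ 1) ℕ.* m ≡ g ℕ.* m ℕ.+ m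
    [g+1]m≡gm+m = ℕ.solve (g ∷ m ∷ [])
    a-[g+1]m≡f-gm : b ℕ.+ 1 ≡ m → + (f ℕ.+ b ℕ.+ 1) - + ((g ℕ.+ 1) ℕ.* m) ≡ + f - + (g ℕ.* m)
    a-[g+1]m≡f-gm k≡m = begin
      + (f ℕ.+ b ℕ.+ 1) - + ((g ℕ.+ 1) ℕ.* m)  ≡⟨ cong₂ (λ a c → + a - + c)
                                                         (trans (ℕ.+-assoc f b 1) (cong (f ℕ.+_) k≡m)) [g+1]m≡gm+m ⟩
      + (f ℕ.+ m) - + (g ℕ.* m ℕ.+ m)          ≡⟨ cancel (+ f) (+ (g ℕ.* m)) (+ m) ⟩
      + f - + (g ℕ.* m)                        ∎

open import Data.Nat using (_+_; _*_; _∸_; _≤_; _<_)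
open import Data.Nat.Divisibility using (_∣_)
open import Function.Bundles using (_⇔_; mk⇔)

theorem4 : (s b f : ℕ) → f ≤ s →
    CoincidingSignatures (s , b , f) ⇔
    Σ ℕ (λ t → Σ ℕ (λ m → Σ ℕ (λ g →
    1 ≤ t × 1 ≤ m × g < t × t ∣ (g * g + g + 1) ×
    IsEquivSig (s , b , f) (t * m ∸ 1 , m ∸ 1 , g * m))))
theorem4 s b f f≤s = mk⇔ (λ (sig2σ≡σ , _) → sig2-fixed⇒cubeRoot f≤s sig2σ≡σ) from
  where
  from : HasCubeRootSignature (s , b , f) → CoincidingSignatures (s , b , f)
  from (t , m , g , 1≤t , 1≤m , g<t , t∣gg+g+1 , σ~τ) =
    subst CoincidingSignatures (sym (σ≡τ σ~τ)) (cubeRootSignature-coinciding 1≤t 1≤m g<t t∣gg+g+1)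
    where
    σ≡τ : IsEquivSig (s , b , f) (cubeRootSignature t m g) → (s , b , f) ≡ cubeRootSignature t m g
    σ≡τ (inj₁ τ≡σ)          = sym τ≡σ
    σ≡τ (inj₂ (inj₁ τ≡sig2σ)) = sig2-reflects-cubeRoot f≤s 1≤t 1≤m g<t t∣gg+g+1 (sym τ≡sig2σ)
    σ≡τ (inj₂ (inj₂ τ≡sig3σ)) = sig3-reflects-cubeRoot f≤s 1≤t 1≤m g<t t∣gg+g+1 (sym τ≡sig3σ)
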